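{- Let $n\ge1$ and let $\widehat\Phi_n$ be the undirected graph with vertex set $\{0,1\}^n$ in which distinct vertices $x,y$ are adjacent if and only if $y-x$ or $x-y$ is an alternating sequence. Let $\theta$ be the map on $\{0,1\}^n$ sending $(a_1,a_2,\ldots,a_n)\mapsto(\overline{a_n},a_1,\ldots,a_{n-1})$, where $\overline{x}=1-x$. Then $\theta$ is an automorphism of the graph $\widehat\Phi_n$.
   Context: A sequence $(\alpha_1,\ldots,\alpha_n)$ is alternating if each $\alpha_i\in\{1,0,-1\}$ and its nonzero entries, read left to right, form the pattern $1,-1,1,-1,\ldots,-1,1$. The graph $\widehat\Phi_n$ is the Hasse diagram of the poset $\Phi_n$ on $\{0,1\}^n$ in which $y$ covers $x$ iff $y-x$ is alternating. -}

module Defs where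

open import Data.Bool using (Bool; true; false; not)
open import Data.Nat using (ℕ; suc)
open import Data.Vec using (Vec; []; _∷_; init; last)
open import Data.List using (List; []; _∷_)
open import Data.Sum using (_⊎_)
open import Data.Product using (_×_)
open import Relation.Binary.PropositionalEquality using (_≢_)

data Sign : Set where
  pos zer neg : Sign

-- Difference of two bits: (b - a) ∈ {1,0,-1}, bits read as 0/1 (false = 0, true = 1).
bitDiff : Bool → Bool → Sign
bitDiff false true  = pos
bitDiff true  false = neg
bitDiff _     _     = zer

diff : ∀ {n} → Vec Bool n → Vec Bool n → List Sign
diff [] [] = []
diff (x ∷ xs) (y ∷ ys) = bitDiff x y ∷ diff xs ys

-- AltFrom s : nonzero entries read left to right form 1,-1,1,...,-1,1
--   (ExpectPos: next nonzero must be 1; ending here is not allowed;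
--    ExpectNeg: last nonzero was 1; next nonzero must be -1; ending here is allowed).
data ExpectPos : List Sign → Set
data ExpectNeg : List Sign → Set

data ExpectPos where
  skip : ∀ {s} → ExpectPos s → ExpectPos (zer ∷ s)
  step : ∀ {s} → ExpectNeg s → ExpectPos (pos ∷ s)

data ExpectNeg where
  done : ExpectNeg []
  skip : ∀ {s} → ExpectNeg s → ExpectNeg (zer ∷ s)
  step : ∀ {s} → ExpectPos s → ExpectNeg (neg ∷ s)

Alternating : List Sign → Set
Alternating = ExpectPos

Adj : ∀ {n} → Vec Bool n → Vec Bool n → Set
Adj x y = x ≢ y × (Alternating (diff x y) ⊎ Alternating (diff y x))

θ : ∀ {n} → Vec Bool n → Vec Bool n
θ [] = []
θ (a ∷ as) = not (last (a ∷ as)) ∷ init (a ∷ as)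

-- Read an alternating sequence as a walk on the heights {0,1} of its partial
-- sums: it starts at 0, each 1 steps up, each -1 steps down, and it ends at 1.
-- So "y - x or x - y is alternating" says that y - x is a walk between the two
-- heights that ends at the height it did not start from. Applying θ to both x
-- and y moves the last entry s of y - x to the front as -s; a walk crossing
-- from one height to the other ending with s becomes one crossing the other
-- way starting with -s, so adjacency is preserved. θ is a bijection since
-- (a₁,…,aₙ) ↦ (a₂,…,aₙ,¬a₁) inverts it.
module Submission where

open import Defs
open import Data.Bool using (Bool; true; false; not)
open import Data.Bool.Properties using (not-involutive)
open import Data.Nat using (ℕ; zero; suc; _≥_)
open import Data.Vec using (Vec; []; _∷_; _∷ʳ_; initLast)
open import Data.Vec.Properties using (init-∷ʳ; last-∷ʳ)
open import Data.List using (List; []; _∷_; _++_; [_])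
open import Data.Product using (_×_; _,_; proj₁; ∃)
open import Data.Sum using (_⊎_; inj₁; inj₂)
open import Data.Sum.Function.Propositional using (_⊎-⇔_)
open import Data.Product.Function.NonDependent.Propositional using (_×-⇔_)
open import Function using (_∘_)
open import Function.Definitions using (Bijective)
open import Function.Bundles using (_⇔_; mk⇔; mk↔ₛ′; Bijection)
import Function.Properties.Equivalence as Equivalence
open Equivalence using () renaming (trans to ⇔-trans)
open import Function.Properties.Inverse using (↔⇒⤖)
open import Relation.Binary.PropositionalEquality
  using (_≡_; _≢_; refl; cong; cong₂; subst₂)

data Height : Set where
  low high : Height

flip : Height → Height
flip low  = high
flip high = low

flip-involutive : ∀ h → flip (flip h) ≡ h
flip-involutive low  = refl
flip-involutive high = refl

negate : Sign → Sign
negate pos = neg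
negate zer = zer
negate neg = pos

negateAll : List Sign → List Sign
negateAll []      = []
negateAll (s ∷ l) = negate s ∷ negateAll l

negateAll-involutive : ∀ l → negateAll (negateAll l) ≡ l
negateAll-involutive []        = refl
negateAll-involutive (pos ∷ l) = cong (pos ∷_) (negateAll-involutive l)
negateAll-involutive (zer ∷ l) = cong (zer ∷_) (negateAll-involutive l)
negateAll-involutive (neg ∷ l) = cong (neg ∷_) (negateAll-involutive l)

infix 4 _─[_]→_

data _─[_]→_ : Height → List Sign → Height → Set where
  []   : ∀ {h} → h ─[ [] ]→ h
  zer∷ : ∀ {h l h′} → h ─[ l ]→ h′ → h ─[ zer ∷ l ]→ h′
  pos∷ : ∀ {l h′} → high ─[ l ]→ h′ → low ─[ pos ∷ l ]→ h′
  neg∷ : ∀ {l h′} → low ─[ l ]→ h′ → high ─[ neg ∷ l ]→ h′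

expectPos⇒walk : ∀ {l} → ExpectPos l → low ─[ l ]→ high
expectNeg⇒walk : ∀ {l} → ExpectNeg l → high ─[ l ]→ high
expectPos⇒walk (skip p) = zer∷ (expectPos⇒walk p)
expectPos⇒walk (step p) = pos∷ (expectNeg⇒walk p)
expectNeg⇒walk done     = []
expectNeg⇒walk (skip p) = zer∷ (expectNeg⇒walk p)
expectNeg⇒walk (step p) = neg∷ (expectPos⇒walk p)

walk⇒expectPos : ∀ {l} → low ─[ l ]→ high → ExpectPos l
walk⇒expectNeg : ∀ {l} → high ─[ l ]→ high → ExpectNeg l
walk⇒expectPos (zer∷ w) = skip (walk⇒expectPos w)
walk⇒expectPos (pos∷ w) = step (walk⇒expectNeg w)
walk⇒expectNeg []       = done
walk⇒expectNeg (zer∷ w) = skip (walk⇒expectNeg w)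
walk⇒expectNeg (neg∷ w) = step (walk⇒expectPos w)

alternating⇔walk : ∀ l → Alternating l ⇔ low ─[ l ]→ high
alternating⇔walk l = mk⇔ expectPos⇒walk walk⇒expectPos

walk-negateAll : ∀ {h l h′} → h ─[ l ]→ h′ → flip h ─[ negateAll l ]→ flip h′
walk-negateAll []       = []
walk-negateAll (zer∷ w) = zer∷ (walk-negateAll w)
walk-negateAll (pos∷ w) = neg∷ (walk-negateAll w)
walk-negateAll (neg∷ w) = pos∷ (walk-negateAll w)

walk-negateAll⁻ : ∀ {h l h′} → flip h ─[ negateAll l ]→ flip h′ → h ─[ l ]→ h′
walk-negateAll⁻ {h} {l} {h′} w =
  subst₂ (λ h₁ h₁′ → h₁ ─[ _ ]→ h₁′) (flip-involutive h) (flip-involutive h′)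
    (subst₂ (λ l₁ h₁ → flip (flip h) ─[ l₁ ]→ h₁) (negateAll-involutive l) refl
      (walk-negateAll w))

walk-++ : ∀ {h h′ h″ l m} → h ─[ l ]→ h′ → h′ ─[ m ]→ h″ → h ─[ l ++ m ]→ h″
walk-++ []       v = v
walk-++ (zer∷ w) v = zer∷ (walk-++ w v)
walk-++ (pos∷ w) v = pos∷ (walk-++ w v)
walk-++ (neg∷ w) v = neg∷ (walk-++ w v)

walk-split : ∀ {h h″} l {m} → h ─[ l ++ m ]→ h″ →
             ∃ λ h′ → h ─[ l ]→ h′ × h′ ─[ m ]→ h″
walk-split []      w        = _ , [] , w
walk-split (_ ∷ l) (zer∷ w) with walk-split l w
... | h′ , u , v = h′ , zer∷ u , v
walk-split (_ ∷ l) (pos∷ w) with walk-split l w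
... | h′ , u , v = h′ , pos∷ u , v
walk-split (_ ∷ l) (neg∷ w) with walk-split l w
... | h′ , u , v = h′ , neg∷ u , v

Crosses : List Sign → Set
Crosses l = low ─[ l ]→ high ⊎ high ─[ l ]→ low

crosses-rotate : ∀ l s → Crosses (l ++ [ s ]) ⇔ Crosses (negate s ∷ l)
crosses-rotate l zer = mk⇔ to from
  where
  to : Crosses (l ++ [ zer ]) → Crosses (zer ∷ l)
  to (inj₁ w) with walk-split l w
  ... | _ , u , zer∷ [] = inj₁ (zer∷ u)
  to (inj₂ w) with walk-split l w
  ... | _ , u , zer∷ [] = inj₂ (zer∷ u)
  from : Crosses (zer ∷ l) → Crosses (l ++ [ zer ])
  from (inj₁ (zer∷ w)) = inj₁ (walk-++ w (zer∷ []))
  from (inj₂ (zer∷ w)) = inj₂ (walk-++ w (zer∷ []))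
crosses-rotate l pos = mk⇔ to from
  where
  to : Crosses (l ++ [ pos ]) → Crosses (neg ∷ l)
  to (inj₁ w) with walk-split l w
  ... | _ , u , pos∷ [] = inj₂ (neg∷ u)
  to (inj₂ w) with walk-split l w
  ... | _ , _ , pos∷ ()
  from : Crosses (neg ∷ l) → Crosses (l ++ [ pos ])
  from (inj₂ (neg∷ w)) = inj₁ (walk-++ w (pos∷ []))
crosses-rotate l neg = mk⇔ to from
  where
  to : Crosses (l ++ [ neg ]) → Crosses (pos ∷ l)
  to (inj₁ w) with walk-split l w
  ... | _ , _ , neg∷ ()
  to (inj₂ w) with walk-split l w
  ... | _ , u , neg∷ [] = inj₁ (pos∷ u)
  from : Crosses (pos ∷ l) → Crosses (l ++ [ neg ])
  from (inj₁ (pos∷ w)) = inj₂ (walk-++ w (neg∷ []))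

alternating-either⇔crosses : ∀ l →
  (Alternating l ⊎ Alternating (negateAll l)) ⇔ Crosses l
alternating-either⇔crosses l =
  alternating⇔walk l ⊎-⇔ ⇔-trans (alternating⇔walk (negateAll l))
                                  (mk⇔ walk-negateAll⁻ walk-negateAll)

bitDiff-swap : ∀ a b → bitDiff b a ≡ negate (bitDiff a b)
bitDiff-swap false false = refl
bitDiff-swap false true  = refl
bitDiff-swap true  false = refl
bitDiff-swap true  true  = refl

bitDiff-not : ∀ a b → bitDiff (not a) (not b) ≡ negate (bitDiff a b)
bitDiff-not false false = refl
bitDiff-not false true  = refl
bitDiff-not true  false = refl
bitDiff-not true  true  = refl

diff-swap : ∀ {n} (x y : Vec Bool n) → diff y x ≡ negateAll (diff x y)
diff-swap []       []       = refl
diff-swap (a ∷ x) (b ∷ y) = cong₂ _∷_ (bitDiff-swap a b) (diff-swap x y)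

diff-∷ʳ : ∀ {n} (x y : Vec Bool n) a b →
          diff (x ∷ʳ a) (y ∷ʳ b) ≡ diff x y ++ [ bitDiff a b ]
diff-∷ʳ []       []       a b = refl
diff-∷ʳ (c ∷ x) (d ∷ y) a b = cong (bitDiff c d ∷_) (diff-∷ʳ x y a b)

adj⇔crosses : ∀ {n} (x y : Vec Bool n) → Adj x y ⇔ (x ≢ y × Crosses (diff x y))
adj⇔crosses x y rewrite diff-swap x y =
  Equivalence.refl ×-⇔ alternating-either⇔crosses (diff x y)

θ⁻¹ : ∀ {n} → Vec Bool n → Vec Bool n
θ⁻¹ []       = []
θ⁻¹ (a ∷ as) = as ∷ʳ not a

θ-∷ʳ : ∀ {n} (xs : Vec Bool n) a → θ (xs ∷ʳ a) ≡ not a ∷ xs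
θ-∷ʳ []       a = refl
θ-∷ʳ (x ∷ xs) a = cong₂ (λ u v → not u ∷ v) (last-∷ʳ a (x ∷ xs)) (init-∷ʳ a (x ∷ xs))

θ-θ⁻¹ : ∀ {n} (x : Vec Bool n) → θ (θ⁻¹ x) ≡ x
θ-θ⁻¹ []       = refl
θ-θ⁻¹ (a ∷ as) rewrite θ-∷ʳ as (not a) | not-involutive a = refl

θ⁻¹-θ : ∀ {n} (x : Vec Bool n) → θ⁻¹ (θ x) ≡ x
θ⁻¹-θ {zero}  [] = refl
θ⁻¹-θ {suc _} x with initLast x
... | xs , a , refl rewrite θ-∷ʳ xs a | not-involutive a = refl

θ-bijective : ∀ {n} → Bijective {A = Vec Bool n} _≡_ _≡_ θ
θ-bijective = Bijection.bijective (↔⇒⤖ (mk↔ₛ′ θ θ⁻¹ θ-θ⁻¹ θ⁻¹-θ))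

θ-≢ : ∀ {n} (x y : Vec Bool n) → x ≢ y ⇔ θ x ≢ θ y
θ-≢ x y = mk⇔ (λ x≢y → x≢y ∘ proj₁ θ-bijective) (λ θx≢θy → θx≢θy ∘ cong θ)

θ-crosses : ∀ {n} (x y : Vec Bool n) → Crosses (diff x y) ⇔ Crosses (diff (θ x) (θ y))
θ-crosses {zero}  [] [] = Equivalence.refl
θ-crosses {suc _} x  y  with initLast x | initLast y
... | xs , a , refl | ys , b , refl
  rewrite diff-∷ʳ xs ys a b | θ-∷ʳ xs a | θ-∷ʳ ys b | bitDiff-not a b =
  crosses-rotate (diff xs ys) (bitDiff a b)

lemma4p8 : (n : ℕ) → n ≥ 1 →
    Bijective {A = Vec Bool n} _≡_ _≡_ θ
      × ((x y : Vec Bool n) → Adj x y ⇔ Adj (θ x) (θ y))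
lemma4p8 _ _ = θ-bijective , λ x y →
  ⇔-trans (adj⇔crosses x y)
    (⇔-trans (θ-≢ x y ×-⇔ θ-crosses x y)
      (Equivalence.sym (adj⇔crosses (θ x) (θ y))))
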